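{- Let $k\ge 4$ be an integer and let $C$ be a circular ordering of the vertex set of the path $P_k=x_1x_2\cdots x_k$. Then $(P_k,C)$ is $LF$-free if and only if it is a $k$-zigzag.
   Context: A circular ordering of a finite set $X$ is a ternary relation $C\subseteq X^3$ such that for all $x,y,z,w\in X$: $(x,y,z)\in C\Rightarrow(y,z,x)\in C$; $(x,y,z)\in C\Rightarrow(x,z,y)\notin C$; $(x,y,z),(x,z,w)\in C\Rightarrow(x,y,w)\in C$; and for distinct $x,y,z$ either $(x,y,z)\in C$ or $(x,z,y)\in C$. Vertices appear in circular order $a_1,\dots,a_m$ if $(a_1,a_i,a_j)\in C$ for all $1<i<j\le m$. A circularly ordered graph $(G,C)$ is $LF$-free if $G$ has no induced triangle, no induced claw $K_{1,3}$, no induced $4$-cycle, and no induced path $y_1y_2y_3y_4$ (edges $y_1y_2,y_2y_3,y_3y_4$) whose vertices appear in circular order $y_1,y_2,y_3,y_4$ or in circular order $y_1,y_3,y_2,y_4$. A circular ordering of the path $x_1\cdots x_k$ is a $k$-zigzag if for every $i\in\{1,\dots,k-3\}$ the vertices $x_i,x_{i+1},x_{i+2},x_{i+3}$ appear either in circular order $x_i,x_{i+1},x_{i+3},x_{i+2}$ or in circular order $x_i,x_{i+2},x_{i+3},x_{i+1}$. -}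

module Defs where

open import Data.Nat using (ℕ; suc)
open import Data.Fin using (Fin; toℕ)
open import Data.Product using (_×_)
open import Data.Sum using (_⊎_)
open import Relation.Nullary using (¬_)
open import Relation.Binary.PropositionalEquality using (_≡_; _≢_)

Ternary : Set → Set₁
Ternary X = X → X → X → Set

record IsCircularOrdering {X : Set} (C : Ternary X) : Set where
  field
    cyclic     : ∀ {x y z} → C x y z → C y z x
    asymmetric : ∀ {x y z} → C x y z → ¬ C x z y
    transitive : ∀ {x y z w} → C x y z → C x z w → C x y w
    total      : ∀ {x y z} → x ≢ y → y ≢ z → x ≢ z → C x y z ⊎ C x z y

InCircOrder4 : {X : Set} → Ternary X → X → X → X → X → Set
InCircOrder4 C a₁ a₂ a₃ a₄ = C a₁ a₂ a₃ × C a₁ a₂ a₄ × C a₁ a₃ a₄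

module _ {V : Set} (E : V → V → Set) where

  InducedTriangle : V → V → V → Set
  InducedTriangle a b c = a ≢ b × b ≢ c × a ≢ c × E a b × E b c × E a c

  InducedClaw : V → V → V → V → Set
  InducedClaw c a b d =
    c ≢ a × c ≢ b × c ≢ d × a ≢ b × a ≢ d × b ≢ d ×
    E c a × E c b × E c d × ¬ E a b × ¬ E a d × ¬ E b d

  InducedC4 : V → V → V → V → Set
  InducedC4 a b c d =
    a ≢ b × a ≢ c × a ≢ d × b ≢ c × b ≢ d × c ≢ d ×
    E a b × E b c × E c d × E d a × ¬ E a c × ¬ E b d

  InducedP4 : V → V → V → V → Set
  InducedP4 y₁ y₂ y₃ y₄ =
    y₁ ≢ y₂ × y₁ ≢ y₃ × y₁ ≢ y₄ × y₂ ≢ y₃ × y₂ ≢ y₄ × y₃ ≢ y₄ ×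
    E y₁ y₂ × E y₂ y₃ × E y₃ y₄ × ¬ E y₁ y₃ × ¬ E y₂ y₄ × ¬ E y₁ y₄

  LFFree : Ternary V → Set
  LFFree C =
    (∀ a b c → ¬ InducedTriangle a b c) ×
    (∀ c a b d → ¬ InducedClaw c a b d) ×
    (∀ a b c d → ¬ InducedC4 a b c d) ×
    (∀ y₁ y₂ y₃ y₄ → InducedP4 y₁ y₂ y₃ y₄ →
        ¬ (InCircOrder4 C y₁ y₂ y₃ y₄ ⊎ InCircOrder4 C y₁ y₃ y₂ y₄))

-- The path P_k = x₁ x₂ ⋯ x_k on vertex set Fin k, where index i stands for x_{i+1}.
PathAdj : (k : ℕ) → Fin k → Fin k → Set
PathAdj k i j = toℕ j ≡ suc (toℕ i) ⊎ toℕ i ≡ suc (toℕ j)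

Zigzag : (k : ℕ) → Ternary (Fin k) → Set
Zigzag k C = ∀ (a b c d : Fin k) →
  toℕ b ≡ suc (toℕ a) → toℕ c ≡ suc (toℕ b) → toℕ d ≡ suc (toℕ c) →
  InCircOrder4 C a b d c ⊎ InCircOrder4 C a c d b

-- On the path x₁⋯x_k the only induced subgraphs among triangles, claws, 4-cycles and
-- 4-paths are the 4-paths of consecutive vertices x_i x_{i+1} x_{i+2} x_{i+3}, read in
-- either direction. Four distinct points on a circle admit six circular orders starting
-- from x_i; the forbidden ones for the path read forwards and backwards take two each,
-- and the remaining two are exactly the zigzag orders. So LF-freeness of a consecutive
-- quadruple in both directions is the same as its being in zigzag order.
module Submission where

open import Defs
open import Data.Nat using (ℕ; _≤_; suc)
open import Data.Fin using (Fin; toℕ)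
open import Data.Fin.Properties using (toℕ-injective)
open import Data.Product using (_×_; _,_)
open import Data.Sum using (_⊎_; inj₁; inj₂; swap)
open import Data.Empty using (⊥; ⊥-elim)
open import Function using (_∘_)
open import Relation.Nullary using (¬_)
open import Relation.Binary.PropositionalEquality using (_≡_; _≢_; refl; sym; cong)

module _ {U V : Set} (f : U → V) (E : V → V → Set) where

  InducedP4-comap : ∀ {a b c d} → InducedP4 E (f a) (f b) (f c) (f d) →
    InducedP4 (λ x y → E (f x) (f y)) a b c d
  InducedP4-comap (ab , ac , ad , bc , bd , cd , rest) =
    ab ∘ cong f , ac ∘ cong f , ad ∘ cong f , bc ∘ cong f , bd ∘ cong f , cd ∘ cong f , rest

module _ {V : Set} {E : V → V → Set} (E-sym : ∀ {x y} → E x y → E y x) where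

  InducedP4-reverse : ∀ {a b c d} → InducedP4 E a b c d → InducedP4 E d c b a
  InducedP4-reverse (ab , ac , ad , bc , bd , cd , eab , ebc , ecd , ¬ac , ¬bd , ¬ad) =
    cd ∘ sym , bd ∘ sym , ad ∘ sym , bc ∘ sym , ac ∘ sym , ab ∘ sym ,
    E-sym ecd , E-sym ebc , E-sym eab , ¬bd ∘ E-sym , ¬ac ∘ E-sym , ¬ad ∘ E-sym

_↗_ : ℕ → ℕ → Set
i ↗ j = j ≡ suc i

Adjacent : ℕ → ℕ → Set
Adjacent i j = i ↗ j ⊎ j ↗ i

Ascending4 : ℕ → ℕ → ℕ → ℕ → Set
Ascending4 i j k l = i ↗ j × j ↗ k × k ↗ l

¬triangle : ∀ {i j k} → Adjacent i j → Adjacent j k → ¬ Adjacent i k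
¬triangle (inj₁ refl) (inj₁ refl) (inj₁ ())
¬triangle (inj₁ refl) (inj₁ refl) (inj₂ ())
¬triangle (inj₁ refl) (inj₂ refl) (inj₁ ())
¬triangle (inj₁ refl) (inj₂ refl) (inj₂ ())
¬triangle (inj₂ refl) (inj₁ refl) (inj₁ ())
¬triangle (inj₂ refl) (inj₁ refl) (inj₂ ())
¬triangle (inj₂ refl) (inj₂ refl) (inj₁ ())
¬triangle (inj₂ refl) (inj₂ refl) (inj₂ ())

¬three-distinct-neighbours : ∀ {c a b d} → Adjacent c a → Adjacent c b → Adjacent c d →
  a ≢ b → a ≢ d → b ≢ d → ⊥
¬three-distinct-neighbours (inj₁ refl) (inj₁ refl) _           a≢b _   _   = a≢b refl
¬three-distinct-neighbours (inj₂ refl) (inj₂ refl) _           a≢b _   _   = a≢b refl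
¬three-distinct-neighbours (inj₁ refl) (inj₂ refl) (inj₁ refl) _   a≢d _   = a≢d refl
¬three-distinct-neighbours (inj₁ refl) (inj₂ refl) (inj₂ refl) _   _   b≢d = b≢d refl
¬three-distinct-neighbours (inj₂ refl) (inj₁ refl) (inj₁ refl) _   _   b≢d = b≢d refl
¬three-distinct-neighbours (inj₂ refl) (inj₁ refl) (inj₂ refl) _   a≢d _   = a≢d refl

walk3-monotone : ∀ {i j k} → Adjacent i j → Adjacent j k → i ≢ k →
  (i ↗ j × j ↗ k) ⊎ (k ↗ j × j ↗ i)
walk3-monotone (inj₁ refl) (inj₁ refl) _   = inj₁ (refl , refl)
walk3-monotone (inj₁ refl) (inj₂ refl) i≢k = ⊥-elim (i≢k refl)
walk3-monotone (inj₂ refl) (inj₁ refl) i≢k = ⊥-elim (i≢k refl)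
walk3-monotone (inj₂ refl) (inj₂ refl) _   = inj₂ (refl , refl)

¬up-down : ∀ {j k} → j ↗ k → ¬ k ↗ j
¬up-down refl ()

walk4-monotone : ∀ {i j k l} → Adjacent i j → Adjacent j k → Adjacent k l → i ≢ k → j ≢ l →
  Ascending4 i j k l ⊎ Ascending4 l k j i
walk4-monotone ij jk kl i≢k j≢l with walk3-monotone ij jk i≢k | walk3-monotone jk kl j≢l
... | inj₁ (p , q) | inj₁ (_ , r) = inj₁ (p , q , r)
... | inj₂ (q , p) | inj₂ (r , _) = inj₂ (r , q , p)
... | inj₁ (_ , q) | inj₂ (_ , q′) = ⊥-elim (¬up-down q q′)
... | inj₂ (q , _) | inj₁ (q′ , _) = ⊥-elim (¬up-down q′ q)

ascending4-ends-¬adjacent : ∀ {i j k l} → Ascending4 i j k l → ¬ Adjacent i l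
ascending4-ends-¬adjacent (refl , refl , refl) (inj₁ ())
ascending4-ends-¬adjacent (refl , refl , refl) (inj₂ ())

ascending4⇒InducedP4 : ∀ {i j k l} → Ascending4 i j k l → InducedP4 Adjacent i j k l
ascending4⇒InducedP4 asc@(refl , refl , refl) =
  (λ ()) , (λ ()) , (λ ()) , (λ ()) , (λ ()) , (λ ()) ,
  inj₁ refl , inj₁ refl , inj₁ refl ,
  (λ { (inj₁ ()) ; (inj₂ ()) }) , (λ { (inj₁ ()) ; (inj₂ ()) }) ,
  ascending4-ends-¬adjacent asc

¬C4 : ∀ {a b c d} → Adjacent a b → Adjacent b c → Adjacent c d → Adjacent d a →
  a ≢ c → b ≢ d → ⊥
¬C4 ab bc cd da a≢c b≢d with walk4-monotone ab bc cd a≢c b≢d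
... | inj₁ asc = ascending4-ends-¬adjacent asc (swap da)
... | inj₂ desc = ascending4-ends-¬adjacent desc da

module _ {X : Set} (C : Ternary X) where

  Forbidden4 : X → X → X → X → Set
  Forbidden4 a b c d = InCircOrder4 C a b c d ⊎ InCircOrder4 C a c b d

  ZigzagOrder4 : X → X → X → X → Set
  ZigzagOrder4 a b c d = InCircOrder4 C a b d c ⊎ InCircOrder4 C a c d b

module _ {X : Set} {C : Ternary X} (co : IsCircularOrdering C) where
  open IsCircularOrdering co

  rotate : ∀ {p q r s} → InCircOrder4 C p q r s → InCircOrder4 C q r s p
  rotate (pqr , pqs , prs) =
    cyclic (cyclic (transitive (cyclic prs) (cyclic (cyclic pqr)))) , cyclic pqr , cyclic pqs

  ZigzagOrder4-reverse : ∀ {a b c d} → ZigzagOrder4 C a b c d → ZigzagOrder4 C d c b a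
  ZigzagOrder4-reverse (inj₁ o) = inj₁ (rotate (rotate o))
  ZigzagOrder4-reverse (inj₂ o) = inj₂ (rotate (rotate o))

  ZigzagOrder4⇒¬Forbidden4 : ∀ {a b c d} → ZigzagOrder4 C a b c d → ¬ Forbidden4 C a b c d
  ZigzagOrder4⇒¬Forbidden4 (inj₁ (_ , _ , adc)) (inj₁ (_ , _ , acd)) = asymmetric acd adc
  ZigzagOrder4⇒¬Forbidden4 (inj₁ (_ , abc , _)) (inj₂ (acb , _ , _)) = asymmetric abc acb
  ZigzagOrder4⇒¬Forbidden4 (inj₂ (_ , acb , _)) (inj₁ (abc , _ , _)) = asymmetric abc acb
  ZigzagOrder4⇒¬Forbidden4 (inj₂ (_ , _ , adb)) (inj₂ (_ , _ , abd)) = asymmetric adb abd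

  Forbidden4-trichotomy : ∀ {a b c d} → a ≢ b → b ≢ c → a ≢ c → a ≢ d → b ≢ d → c ≢ d →
    Forbidden4 C a b c d ⊎ Forbidden4 C d c b a ⊎ ZigzagOrder4 C a b c d
  Forbidden4-trichotomy {a} {b} {c} {d} ab bc ac ad bd cd
    with total {a} {b} {c} ab bc ac | total {a} {b} {d} ab bd ad | total {a} {c} {d} ac cd ad
  ... | inj₁ abc | inj₁ abd | inj₁ acd = inj₁ (inj₁ (abc , abd , acd))
  ... | inj₁ abc | inj₁ abd | inj₂ adc = inj₂ (inj₂ (inj₁ (abd , abc , adc)))
  ... | inj₁ abc | inj₂ adb | inj₁ acd = ⊥-elim (asymmetric (transitive abc acd) adb)
  ... | inj₁ abc | inj₂ adb | inj₂ adc = inj₂ (inj₁ (inj₂ (rotate (adb , adc , abc))))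
  ... | inj₂ acb | inj₁ abd | inj₁ acd = inj₁ (inj₂ (acb , acd , abd))
  ... | inj₂ acb | inj₁ abd | inj₂ adc = ⊥-elim (asymmetric (transitive adc acb) abd)
  ... | inj₂ acb | inj₂ adb | inj₁ acd = inj₂ (inj₂ (inj₂ (acd , acb , adb)))
  ... | inj₂ acb | inj₂ adb | inj₂ adc = inj₂ (inj₁ (inj₁ (rotate (adc , adb , acb))))

module _ {k : ℕ} where

  toℕ-≢ : {x y : Fin k} → x ≢ y → toℕ x ≢ toℕ y
  toℕ-≢ x≢y = x≢y ∘ toℕ-injective

  ascending4⇒InducedP4-path : ∀ {a b c d} → Ascending4 (toℕ a) (toℕ b) (toℕ c) (toℕ d) →
    InducedP4 (PathAdj k) a b c d
  ascending4⇒InducedP4-path = InducedP4-comap toℕ Adjacent ∘ ascending4⇒InducedP4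

module _ {k : ℕ} {C : Ternary (Fin k)} (co : IsCircularOrdering C) where

  LFFree⇒Zigzag : LFFree (PathAdj k) C → Zigzag k C
  LFFree⇒Zigzag (_ , _ , _ , ¬forbidden) a b c d p q r
    with forward ← ascending4⇒InducedP4-path (p , q , r)
    with (ab , ac , ad , bc , bd , cd , _) ← forward
    with Forbidden4-trichotomy co ab bc ac ad bd cd
  ... | inj₁ f = ⊥-elim (¬forbidden a b c d forward f)
  ... | inj₂ (inj₁ f) = ⊥-elim (¬forbidden d c b a (InducedP4-reverse swap forward) f)
  ... | inj₂ (inj₂ z) = z

  zigzag-on-monotone : Zigzag k C → ∀ {a b c d} →
    Ascending4 (toℕ a) (toℕ b) (toℕ c) (toℕ d) ⊎ Ascending4 (toℕ d) (toℕ c) (toℕ b) (toℕ a) →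
    ZigzagOrder4 C a b c d
  zigzag-on-monotone zz (inj₁ (p , q , r)) = zz _ _ _ _ p q r
  zigzag-on-monotone zz (inj₂ (p , q , r)) = ZigzagOrder4-reverse co (zz _ _ _ _ p q r)

  Zigzag⇒LFFree : Zigzag k C → LFFree (PathAdj k) C
  Zigzag⇒LFFree zz = triangle , claw , cycle , path
    where
    triangle : ∀ a b c → ¬ InducedTriangle (PathAdj k) a b c
    triangle _ _ _ (_ , _ , _ , ab , bc , ac) = ¬triangle ab bc ac

    claw : ∀ c a b d → ¬ InducedClaw (PathAdj k) c a b d
    claw _ _ _ _ (_ , _ , _ , a≢b , a≢d , b≢d , ca , cb , cd , _) =
      ¬three-distinct-neighbours ca cb cd (toℕ-≢ a≢b) (toℕ-≢ a≢d) (toℕ-≢ b≢d)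

    cycle : ∀ a b c d → ¬ InducedC4 (PathAdj k) a b c d
    cycle _ _ _ _ (_ , a≢c , _ , _ , b≢d , _ , ab , bc , cd , da , _) =
      ¬C4 ab bc cd da (toℕ-≢ a≢c) (toℕ-≢ b≢d)

    path : ∀ y₁ y₂ y₃ y₄ → InducedP4 (PathAdj k) y₁ y₂ y₃ y₄ → ¬ Forbidden4 C y₁ y₂ y₃ y₄
    path _ _ _ _ (_ , y₁≢y₃ , _ , _ , y₂≢y₄ , _ , e₁₂ , e₂₃ , e₃₄ , _) =
      ZigzagOrder4⇒¬Forbidden4 co
        (zigzag-on-monotone zz (walk4-monotone e₁₂ e₂₃ e₃₄ (toℕ-≢ y₁≢y₃) (toℕ-≢ y₂≢y₄)))

mainTheorem19 : (k : ℕ) → 4 ≤ k → (C : Ternary (Fin k)) → IsCircularOrdering C →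
    (LFFree (PathAdj k) C → Zigzag k C) × (Zigzag k C → LFFree (PathAdj k) C)
mainTheorem19 k _ C co = LFFree⇒Zigzag co , Zigzag⇒LFFree co
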